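{- If an ASM $A$ is adjacent to an ASM $B$ in the graph of the polytope $ASM_n$ (i.e. $A$ and $B$ are the two vertices of a 1-dimensional face), then $C=B-A$ is a cycle matrix.
   Context: An $n\times n$ alternating sign matrix (ASM) is a matrix with entries in $\{0,1,-1\}$ whose rows and columns each sum to $1$ and in which the nonzero entries of each row and of each column alternate in sign. $ASM_n\subset\mathbb{R}^{n\times n}$ is the convex hull of all $n\times n$ ASMs; its vertices are exactly the $n\times n$ ASMs. The $n\times n$ grid graph has vertices $(i,j)$, $1\le i,j\le n$, with $(i,j)$ adjacent to $(i,j\pm1)$ and $(i\pm1,j)$. A corner of a simple cycle $K$ in the grid graph is a vertex of $K$ incident to one horizontal and one vertical edge of $K$. A cycle matrix is an $n\times n$ matrix whose nonzero entries are exactly in the positions corresponding to the corners of some simple cycle $K$ of the $n\times n$ grid graph and alternate between $1$ and $-1$ as one goes around $K$.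
   Formalization: The linear functional that exposes the 1-dimensional face with vertices $A$ and $B$ of $ASM_n$ has rational coefficients. -}

module Defs where

open import Data.Nat as ℕ using (ℕ; zero; suc; _<_; _≤_)
open import Data.Nat.DivMod using (_mod_)
import Data.Nat.Properties as ℕₚ
open import Data.Fin using (Fin; toℕ)
open import Data.Integer as ℤ using (ℤ; +_; -_)
open import Data.Rational as ℚ using (ℚ)
open import Data.List using (List; []; _∷_)
open import Data.Product using (Σ; ∃; _×_; _,_)
open import Data.Sum using (_⊎_)
open import Data.Empty using (⊥)
open import Relation.Nullary using (¬_)
open import Relation.Binary.PropositionalEquality using (_≡_; _≢_)
open import Function.Bundles using (_⇔_)

-- n × n integer matrices, indexed by (row, column)
Matrix : ℕ → Set
Matrix n = Fin n → Fin n → ℤ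

_-ᴹ_ : ∀ {n} → Matrix n → Matrix n → Matrix n
(B -ᴹ A) i j = B i j ℤ.+ (- A i j)

sumFinℤ : ∀ {n} → (Fin n → ℤ) → ℤ
sumFinℤ {zero}  f = + 0
sumFinℤ {suc n} f = f Data.Fin.zero ℤ.+ sumFinℤ (λ i → f (Data.Fin.suc i))

sumFinℚ : ∀ {n} → (Fin n → ℚ) → ℚ
sumFinℚ {zero}  f = ℚ.0ℚ
sumFinℚ {suc n} f = f Data.Fin.zero ℚ.+ sumFinℚ (λ i → f (Data.Fin.suc i))

toList : ∀ {n} → (Fin n → ℤ) → List ℤ
toList {zero}  f = []
toList {suc n} f = f Data.Fin.zero ∷ toList (λ i → f (Data.Fin.suc i))

nonzeros : List ℤ → List ℤ
nonzeros [] = []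
nonzeros (+ 0 ∷ xs) = nonzeros xs
nonzeros (x ∷ xs) = x ∷ nonzeros xs

-- consecutive entries have opposite signs (entries will be ±1)
data Alternating : List ℤ → Set where
  alt[]  : Alternating []
  alt[_] : ∀ x → Alternating (x ∷ [])
  alt∷   : ∀ {x y xs} → y ≡ - x → Alternating (y ∷ xs) → Alternating (x ∷ y ∷ xs)

record IsASM {n : ℕ} (A : Matrix n) : Set where
  field
    entries   : ∀ i j → (A i j ≡ + 0) ⊎ (A i j ≡ + 1) ⊎ (A i j ≡ - (+ 1))
    rowSum    : ∀ i → sumFinℤ (λ j → A i j) ≡ + 1
    colSum    : ∀ j → sumFinℤ (λ i → A i j) ≡ + 1
    rowAlt    : ∀ i → Alternating (nonzeros (toList (λ j → A i j)))
    colAlt    : ∀ j → Alternating (nonzeros (toList (λ i → A i j)))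

⟨_,_⟩ : ∀ {n} → (Fin n → Fin n → ℚ) → Matrix n → ℚ
⟨ c , X ⟩ = sumFinℚ (λ i → sumFinℚ (λ j → c i j ℚ.* (X i j ℚ./ 1)))

-- A and B are adjacent in the graph of the polytope ASM_n: A ≠ B and
-- {A , B} is the vertex set of a face, i.e. some linear functional c is
-- maximised over the ASMs (the vertices) exactly at A and B.
AdjacentInASMPolytope : ∀ {n} → Matrix n → Matrix n → Set
AdjacentInASMPolytope {n} A B =
  IsASM A × IsASM B × (¬ (∀ i j → A i j ≡ B i j)) ×
  Σ (Fin n → Fin n → ℚ) λ c →
    (⟨ c , A ⟩ ≡ ⟨ c , B ⟩) ×
    (∀ (X : Matrix n) → IsASM X →
       ¬ (∀ i j → X i j ≡ A i j) → ¬ (∀ i j → X i j ≡ B i j) →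
       ⟨ c , X ⟩ ℚ.< ⟨ c , A ⟩)

Vertex : ℕ → Set
Vertex n = Fin n × Fin n

row col : ∀ {n} → Vertex n → Fin n
row (i , j) = i
col (i , j) = j

Nbr : ℕ → ℕ → Set
Nbr a b = (suc a ≡ b) ⊎ (suc b ≡ a)

HEdge : ∀ {n} → Vertex n → Vertex n → Set
HEdge (i , j) (i' , j') = (i ≡ i') × Nbr (toℕ j) (toℕ j')

VEdge : ∀ {n} → Vertex n → Vertex n → Set
VEdge (i , j) (i' , j') = (j ≡ j') × Nbr (toℕ i) (toℕ i')

GridAdj : ∀ {n} → Vertex n → Vertex n → Set
GridAdj u v = HEdge u v ⊎ VEdge u v

cshift : ∀ {m} .{{_ : ℕ.NonZero m}} → Fin m → ℕ → Fin m
cshift {m} k d = (toℕ k ℕ.+ d) mod m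

-- a simple cycle of length len = 3 + r (≥ 3) in the n × n grid graph, given
-- by its pairwise distinct vertices v 0, v 1, …, v (len-1) in cyclic order
record SimpleCycle (n : ℕ) : Set where
  field
    r       : ℕ
    v       : Fin (suc (suc (suc r))) → Vertex n
    inj     : ∀ k l → v k ≡ v l → k ≡ l
    adj     : ∀ k → GridAdj (v k) (v (cshift k 1))

open SimpleCycle public

len : ∀ {n} → SimpleCycle n → ℕ
len K = suc (suc (suc (r K)))

next prev : ∀ {n} (K : SimpleCycle n) → Fin (len K) → Fin (len K)
next K k = cshift k 1
prev K k = cshift k (len K ℕ.∸ 1)

IsCorner : ∀ {n} (K : SimpleCycle n) → Fin (len K) → Set
IsCorner K k =
    (HEdge (v K (prev K k)) (v K k) × VEdge (v K k) (v K (next K k)))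
  ⊎ (VEdge (v K (prev K k)) (v K k) × HEdge (v K k) (v K (next K k)))

IsCycleMatrixOf : ∀ {n} → Matrix n → SimpleCycle n → Set
IsCycleMatrixOf {n} C K =
  (∀ i j → (C i j ≢ + 0) ⇔ (Σ (Fin (len K)) λ k → IsCorner K k × (v K k ≡ (i , j)))) ×
  (∀ i j → C i j ≢ + 0 → (C i j ≡ + 1) ⊎ (C i j ≡ - (+ 1))) ×
  -- going around K, consecutive corners carry opposite signs
  (∀ (k : Fin (len K)) (d : ℕ) → IsCorner K k → 1 ≤ d → d < len K →
     IsCorner K (cshift k d) →
     (∀ e → 1 ≤ e → e < d → ¬ IsCorner K (cshift k e)) →
     C (row (v K (cshift k d))) (col (v K (cshift k d)))
       ≡ - C (row (v K k)) (col (v K k)))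

IsCycleMatrix : ∀ {n} → Matrix n → Set
IsCycleMatrix {n} C = Σ (SimpleCycle n) λ K → IsCycleMatrixOf C K

{-# OPTIONS --safe #-}

-- Record a matrix M by its height function: the partial sums of its rows and columns,
-- placed on the horizontal and vertical edges of the n × n grid. M is an ASM exactly when
-- all heights are 0 or 1, starting from 0 and ending at 1 along every line. For ASMs
-- A ≠ B the difference φ of their height functions is therefore a circulation with values
-- in {0, ±1}, and following its unit flow from a vertex where A and B differ closes up
-- into a simple cycle K. Adding the part ψ of φ carried by K to the heights of A, and
-- subtracting it from those of B, gives the height functions of ASMs X and Y with
-- X + Y = A + B and X ≠ A. When A and B are adjacent, a functional maximised exactly on
-- {A, B} forces X ∈ {A, B}, so X = B and B − A is the horizontal net outflow of the unit
-- flow around K: ±1 exactly at the corners of K, with signs alternating along K.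

module Submission where

open import Defs
open import Algebra.Bundles using (CommutativeMonoid)
open import Data.Bool using (Bool; true; false; not; if_then_else_)
import Data.Bool.Properties as Boolₚ
open import Data.Empty using (⊥; ⊥-elim)
open import Data.Fin as Fin using (Fin; toℕ; fromℕ<)
import Data.Fin.Properties as Finₚ
open import Data.Integer as ℤ using (ℤ; +_; -_; +≤+; -≤+)
import Data.Integer.Properties as ℤₚ
open import Data.Integer.Tactic.RingSolver using (solve-∀)
open import Data.List using ([]; _∷_)
open import Data.Nat as ℕ using (ℕ; zero; suc; _+_; _∸_; _≤_; _<_; _%_; NonZero; s≤s; z≤n)
import Data.Nat.Properties as ℕₚ
open import Data.Nat.DivMod using (%-distribˡ-+; m%n%n≡m%n; [m+n]%n≡m%n; m<n⇒m%n≡m; n%n≡0)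
open import Data.Product using (Σ; _×_; _,_; proj₁; proj₂)
import Data.Product.Properties as Σₚ
open import Data.Rational as ℚ using (ℚ)
import Data.Rational.Properties as ℚₚ
import Data.Rational.Unnormalised as ℚᵘ
import Data.Rational.Unnormalised.Properties as ℚᵘₚ
open import Data.Sum using (_⊎_; inj₁; inj₂; [_,_]; [_,_]′)
import Data.Sum.Properties as ⊎ₚ
open import Function using (_∘_; _∋_; id)
open import Function.Bundles using (_⇔_; mk⇔; Equivalence)
open import Relation.Binary.Definitions using (DecidableEquality)
open import Relation.Binary.PropositionalEquality hiding ([_])
open import Relation.Nullary using (¬_; Dec; yes; no; does)
open import Relation.Nullary.Decidable using (map′; _⊎-dec_; dec-true; dec-false)
open import Relation.Unary using (Decidable)
open import Algebra.Properties.CommutativeSemigroup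
  (CommutativeMonoid.commutativeSemigroup ℚₚ.+-0-commutativeMonoid) using (interchange)

-- Partial sums of ASM lines

data Bit : ℤ → Set where
  bit0 : Bit (+ 0)
  bit1 : Bit (+ 1)

data Trit : ℤ → Set where
  trit0  : Trit (+ 0)
  trit+1 : Trit (+ 1)
  trit-1 : Trit (- + 1)

bit-difference : ∀ {x y} → Bit x → Bit y → Trit (y ℤ.- x)
bit-difference bit0 bit0 = trit0
bit-difference bit0 bit1 = trit+1
bit-difference bit1 bit0 = trit-1
bit-difference bit1 bit1 = trit0

bits-between : ∀ {a b x} → Bit a → Bit b → (x ≡ b ℤ.- a) ⊎ (x ≡ + 0) → Bit (a ℤ.+ x) × Bit (b ℤ.+ - x)
bits-between {a} {b} bit-a bit-b (inj₁ refl) = subst Bit (sym (up a b)) bit-b , subst Bit (sym (down a b)) bit-a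
  where
  up : ∀ a b → a ℤ.+ (b ℤ.- a) ≡ b
  up = solve-∀
  down : ∀ a b → b ℤ.+ - (b ℤ.- a) ≡ a
  down = solve-∀
bits-between {a} {b} bit-a bit-b (inj₂ refl) =
  subst Bit (sym (ℤₚ.+-identityʳ a)) bit-a , subst Bit (sym (ℤₚ.+-identityʳ b)) bit-b

trit-neg : ∀ {x} → Trit x → Trit (- x)
trit-neg trit0  = trit0
trit-neg trit+1 = trit-1
trit-neg trit-1 = trit+1

Entry : ℤ → Set
Entry x = (x ≡ + 0) ⊎ (x ≡ + 1) ⊎ (x ≡ - (+ 1))

trit⇒entry : ∀ {x} → Trit x → Entry x
trit⇒entry trit0  = inj₁ refl
trit⇒entry trit+1 = inj₂ (inj₁ refl)
trit⇒entry trit-1 = inj₂ (inj₂ refl)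

entry⇒trit : ∀ {x} → Entry x → Trit x
entry⇒trit (inj₁ refl)        = trit0
entry⇒trit (inj₂ (inj₁ refl)) = trit+1
entry⇒trit (inj₂ (inj₂ refl)) = trit-1

prefix : ∀ {n} → (Fin n → ℤ) → ℕ → ℤ
prefix {zero}  f _       = + 0
prefix {suc n} f zero    = + 0
prefix {suc n} f (suc j) = f Fin.zero ℤ.+ prefix (f ∘ Fin.suc) j

prefix-zero : ∀ {n} (f : Fin n → ℤ) → prefix f 0 ≡ + 0
prefix-zero {zero}  f = refl
prefix-zero {suc n} f = refl

prefix-suc : ∀ {n} (f : Fin n → ℤ) (j : Fin n) → prefix f (suc (toℕ j)) ≡ prefix f (toℕ j) ℤ.+ f j
prefix-suc {suc n} f Fin.zero
  rewrite prefix-zero (f ∘ Fin.suc) = ℤₚ.+-comm (f Fin.zero) (+ 0)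
prefix-suc {suc n} f (Fin.suc j)
  rewrite prefix-suc (f ∘ Fin.suc) j = sym (ℤₚ.+-assoc (f Fin.zero) _ _)

prefix-full : ∀ {n} (f : Fin n → ℤ) → prefix f n ≡ sumFinℤ f
prefix-full {zero}  f = refl
prefix-full {suc n} f = cong (ℤ._+_ (f Fin.zero)) (prefix-full (f ∘ Fin.suc))

sum-telescope : ∀ {n} (f : Fin n → ℤ) (g : ℕ → ℤ) →
  (∀ j → f j ≡ g (suc (toℕ j)) ℤ.- g (toℕ j)) → sumFinℤ f ≡ g n ℤ.- g 0
sum-telescope {zero}  f g f≡Δg = sym (ℤₚ.+-inverseʳ (g 0))
sum-telescope {suc n} f g f≡Δg = begin
  f Fin.zero ℤ.+ sumFinℤ (f ∘ Fin.suc)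
    ≡⟨ cong₂ ℤ._+_ (f≡Δg Fin.zero) (sum-telescope (f ∘ Fin.suc) (g ∘ suc) (f≡Δg ∘ Fin.suc)) ⟩
  (g 1 ℤ.- g 0) ℤ.+ (g (suc n) ℤ.- g 1)
    ≡⟨ collapse (g 0) (g 1) (g (suc n)) ⟩
  g (suc n) ℤ.- g 0
    ∎
  where
  open ≡-Reasoning
  collapse : ∀ a b c → (b ℤ.- a) ℤ.+ (c ℤ.- b) ≡ c ℤ.- a
  collapse = solve-∀

constant-on-≤ : ∀ {n} (g : ℕ → ℤ) → (∀ (j : Fin n) → g (suc (toℕ j)) ≡ g (toℕ j)) →
  ∀ j → j ≤ n → g j ≡ g 0
constant-on-≤ g step zero    _   = refl
constant-on-≤ g step (suc j) j<n =
  trans (cong (g ∘ suc) (sym (Finₚ.toℕ-fromℕ< j<n)))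
        (trans (step (Fin.fromℕ< j<n))
               (trans (cong g (Finₚ.toℕ-fromℕ< j<n)) (constant-on-≤ g step j (ℕₚ.<⇒≤ j<n))))

record IsASMLine {n} (f : Fin n → ℤ) : Set where
  field
    trit        : ∀ j → Trit (f j)
    alternating : Alternating (nonzeros (toList f))
    sum≡1       : sumFinℤ f ≡ + 1

-- Read from the left, a line whose partial sum so far is s ∈ {0,1} continues exactly
-- like one whose last nonzero entry was 2s − 1.
precedingSign : ℤ → ℤ
precedingSign s = s ℤ.+ s ℤ.- + 1

alternating-tail : ∀ {x xs} → Alternating (x ∷ xs) → Alternating xs
alternating-tail alt[ x ]  = alt[]
alternating-tail (alt∷ _ a) = a

advance : ∀ {s x xs} → Bit s → Trit x →
  Alternating (precedingSign s ∷ nonzeros (x ∷ xs)) →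
  Bit (s ℤ.+ x) × Alternating (precedingSign (s ℤ.+ x) ∷ nonzeros xs)
advance bit0 trit0  a          = bit0 , a
advance bit0 trit+1 (alt∷ _ a) = bit1 , a
advance bit0 trit-1 (alt∷ () _)
advance bit1 trit0  a          = bit1 , a
advance bit1 trit+1 (alt∷ () _)
advance bit1 trit-1 (alt∷ _ a) = bit0 , a

retreat : ∀ {s s' xs} → Bit s → Bit s' →
  Alternating (precedingSign s' ∷ nonzeros xs) →
  Alternating (precedingSign s ∷ nonzeros ((s' ℤ.- s) ∷ xs))
retreat bit0 bit0 a = a
retreat bit0 bit1 a = alt∷ refl a
retreat bit1 bit0 a = alt∷ refl a
retreat bit1 bit1 a = a

alternating⇒prefix-bit : ∀ {n} (f : Fin n → ℤ) {s} → Bit s → (∀ j → Trit (f j)) →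
  Alternating (precedingSign s ∷ nonzeros (toList f)) → ∀ j → Bit (s ℤ.+ prefix f j)
alternating⇒prefix-bit {zero}  f {s} b _ _ _    = subst Bit (sym (ℤₚ.+-identityʳ s)) b
alternating⇒prefix-bit {suc n} f {s} b _ _ zero = subst Bit (sym (ℤₚ.+-identityʳ s)) b
alternating⇒prefix-bit {suc n} f {s} b t a (suc j) with advance b (t Fin.zero) a
... | b' , a' = subst Bit (ℤₚ.+-assoc s (f Fin.zero) _)
                  (alternating⇒prefix-bit (f ∘ Fin.suc) b' (t ∘ Fin.suc) a' j)

bits⇒alternating : ∀ {n} (f : Fin n → ℤ) (g : ℕ → ℤ) → (∀ j → Bit (g j)) →
  (∀ j → f j ≡ g (suc (toℕ j)) ℤ.- g (toℕ j)) →
  Alternating (precedingSign (g 0) ∷ nonzeros (toList f))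
bits⇒alternating {zero}  f g _   _    = alt[ _ ]
bits⇒alternating {suc n} f g bit f≡Δg rewrite f≡Δg Fin.zero =
  retreat (bit 0) (bit 1) (bits⇒alternating (f ∘ Fin.suc) (g ∘ suc) (bit ∘ suc) (f≡Δg ∘ Fin.suc))

prepend-sign : ∀ {n} (f : Fin n → ℤ) → (∀ j → Trit (f j)) → Alternating (nonzeros (toList f)) →
  Alternating (precedingSign (+ 0) ∷ nonzeros (toList f)) ⊎
  Alternating (precedingSign (+ 1) ∷ nonzeros (toList f))
prepend-sign {zero}  f t a = inj₁ alt[ _ ]
prepend-sign {suc n} f t a = prepend (t Fin.zero) a
  where
  prepend : ∀ {x} → Trit x → Alternating (nonzeros (x ∷ toList (f ∘ Fin.suc))) →
    Alternating (precedingSign (+ 0) ∷ nonzeros (x ∷ toList (f ∘ Fin.suc))) ⊎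
    Alternating (precedingSign (+ 1) ∷ nonzeros (x ∷ toList (f ∘ Fin.suc)))
  prepend trit0  a = prepend-sign (f ∘ Fin.suc) (t ∘ Fin.suc) a
  prepend trit+1 a = inj₁ (alt∷ refl a)
  prepend trit-1 a = inj₂ (alt∷ refl a)

asmLine⇒prefix-bit : ∀ {n} {f : Fin n → ℤ} → IsASMLine f → ∀ j → Bit (prefix f j)
asmLine⇒prefix-bit {n} {f} line j with prepend-sign f (IsASMLine.trit line) (IsASMLine.alternating line)
... | inj₁ a = subst Bit (ℤₚ.+-identityˡ _) (alternating⇒prefix-bit f bit0 (IsASMLine.trit line) a j)
-- A line opening with −1 would have partial sums starting from 1 and ending at 1 + 1.
... | inj₂ a = ⊥-elim (no-bit-2 (subst Bit (cong (ℤ._+_ (+ 1)) total≡1)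
                                   (alternating⇒prefix-bit f bit1 (IsASMLine.trit line) a n)))
  where
  total≡1 : prefix f n ≡ + 1
  total≡1 = trans (prefix-full f) (IsASMLine.sum≡1 line)
  no-bit-2 : ¬ Bit (+ 2)
  no-bit-2 ()

bits⇒asmLine : ∀ {n} (f : Fin n → ℤ) (g : ℕ → ℤ) → (∀ j → Bit (g j)) →
  g 0 ≡ + 0 → g n ≡ + 1 → (∀ j → f j ≡ g (suc (toℕ j)) ℤ.- g (toℕ j)) → IsASMLine f
bits⇒asmLine f g bit g0≡0 gn≡1 f≡Δg = record
  { trit        = λ j → subst Trit (sym (f≡Δg j)) (bit-difference (bit _) (bit _))
  ; alternating = alternating-tail
      (subst (λ s → Alternating (precedingSign s ∷ nonzeros (toList f))) g0≡0 (bits⇒alternating f g bit f≡Δg))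
  ; sum≡1       = trans (sum-telescope f g f≡Δg) (cong₂ ℤ._-_ gn≡1 g0≡0)
  }

prefix-difference : ∀ {n} (f : Fin n → ℤ) (j : Fin n) →
  prefix f (suc (toℕ j)) ℤ.- prefix f (toℕ j) ≡ f j
prefix-difference f j = trans (cong (ℤ._- prefix f (toℕ j)) (prefix-suc f j)) (cancel (prefix f (toℕ j)) (f j))
  where
  cancel : ∀ a b → (a ℤ.+ b) ℤ.- a ≡ b
  cancel = solve-∀

asm-row : ∀ {n} {M : Matrix n} → IsASM M → ∀ i → IsASMLine (M i)
asm-row asm i = record
  { trit = λ j → entry⇒trit (entries i j) ; alternating = rowAlt i ; sum≡1 = rowSum i }
  where open IsASM asm

asm-column : ∀ {n} {M : Matrix n} → IsASM M → ∀ j → IsASMLine (λ i → M i j)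
asm-column asm j = record
  { trit = λ i → entry⇒trit (entries i j) ; alternating = colAlt j ; sum≡1 = colSum j }
  where open IsASM asm

-- Height functions and circulations

-- hor i j is the edge of row i entering column j from the left, ver i j the edge of
-- column j entering row i from above; index 0 and index n are the boundary edges.
Edge : ℕ → Set
Edge n = (Fin n × ℕ) ⊎ (ℕ × Fin n)

pattern hor i j = inj₁ (i , j)
pattern ver i j = inj₂ (i , j)

Flow : ℕ → Set
Flow n = Edge n → ℤ

_+ᶠ_ : ∀ {n} → Flow n → Flow n → Flow n
(φ +ᶠ ψ) e = φ e ℤ.+ ψ e

_-ᶠ_ : ∀ {n} → Flow n → Flow n → Flow n
(φ -ᶠ ψ) e = φ e ℤ.- ψ e

-ᶠ_ : ∀ {n} → Flow n → Flow n
(-ᶠ φ) e = - φ e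

_+ᴹ_ : ∀ {n} → Matrix n → Matrix n → Matrix n
(A +ᴹ B) i j = A i j ℤ.+ B i j

rowDiff colDiff : ∀ {n} → Flow n → Matrix n
rowDiff φ i j = φ (hor i (suc (toℕ j))) ℤ.- φ (hor i (toℕ j))
colDiff φ i j = φ (ver (suc (toℕ i)) j) ℤ.- φ (ver (toℕ i) j)

record IsHeightFunction {n} (M : Matrix n) (η : Flow n) : Set where
  field
    bit      : ∀ e → Bit (η e)
    left     : ∀ i → η (hor i 0) ≡ + 0
    right    : ∀ i → η (hor i n) ≡ + 1
    top      : ∀ j → η (ver 0 j) ≡ + 0
    bottom   : ∀ j → η (ver n j) ≡ + 1
    rowDiff≡ : ∀ i j → rowDiff η i j ≡ M i j
    colDiff≡ : ∀ i j → colDiff η i j ≡ M i j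

record IsCirculation {n} (φ : Flow n) : Set where
  field
    left      : ∀ i → φ (hor i 0) ≡ + 0
    right     : ∀ i → φ (hor i n) ≡ + 0
    top       : ∀ j → φ (ver 0 j) ≡ + 0
    bottom    : ∀ j → φ (ver n j) ≡ + 0
    conserved : ∀ i j → rowDiff φ i j ≡ colDiff φ i j

heights : ∀ {n} → Matrix n → Flow n
heights M (hor i j) = prefix (M i) j
heights M (ver i j) = prefix (λ k → M k j) i

asm⇒heightFunction : ∀ {n} {M : Matrix n} → IsASM M → IsHeightFunction M (heights M)
asm⇒heightFunction {n} {M} asm = record
  { bit      = bit
  ; left     = λ i → prefix-zero (M i)
  ; right    = λ i → trans (prefix-full (M i)) (rowSum i)
  ; top      = λ j → prefix-zero (λ k → M k j)
  ; bottom   = λ j → trans (prefix-full (λ k → M k j)) (colSum j)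
  ; rowDiff≡ = λ i j → prefix-difference (M i) j
  ; colDiff≡ = λ i j → prefix-difference (λ k → M k j) i
  }
  where
  open IsASM asm
  bit : ∀ e → Bit (heights M e)
  bit (hor i j) = asmLine⇒prefix-bit (asm-row asm i) j
  bit (ver i j) = asmLine⇒prefix-bit (asm-column asm j) i

heightFunction⇒asm : ∀ {n} {M : Matrix n} {η : Flow n} → IsHeightFunction M η → IsASM M
heightFunction⇒asm {n} {M} {η} hf = record
  { entries = λ i j → trit⇒entry (IsASMLine.trit (rowLine i) j)
  ; rowSum  = IsASMLine.sum≡1 ∘ rowLine
  ; colSum  = IsASMLine.sum≡1 ∘ columnLine
  ; rowAlt  = IsASMLine.alternating ∘ rowLine
  ; colAlt  = IsASMLine.alternating ∘ columnLine
  }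
  where
  open IsHeightFunction hf
  rowLine : ∀ i → IsASMLine (M i)
  rowLine i = bits⇒asmLine (M i) (λ j → η (hor i j)) (λ j → bit (hor i j))
            (left i) (right i) (λ j → sym (rowDiff≡ i j))
  columnLine : ∀ j → IsASMLine (λ i → M i j)
  columnLine j = bits⇒asmLine (λ i → M i j) (λ i → η (ver i j)) (λ i → bit (ver i j))
               (top j) (bottom j) (λ i → sym (colDiff≡ i j))

module _ {n : ℕ} (φ ψ : Flow n) (i j : Fin n) where
  private
    Δ-+ : ∀ a b c d → (a ℤ.+ b) ℤ.- (c ℤ.+ d) ≡ (a ℤ.- c) ℤ.+ (b ℤ.- d)
    Δ-+ = solve-∀
    Δ-− : ∀ a b c d → (a ℤ.- b) ℤ.- (c ℤ.- d) ≡ (a ℤ.- c) ℤ.- (b ℤ.- d)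
    Δ-− = solve-∀

  rowDiff-+ : rowDiff (φ +ᶠ ψ) i j ≡ rowDiff φ i j ℤ.+ rowDiff ψ i j
  rowDiff-+ = Δ-+ (φ (hor i (suc (toℕ j)))) (ψ (hor i (suc (toℕ j)))) (φ (hor i (toℕ j))) (ψ (hor i (toℕ j)))

  colDiff-+ : colDiff (φ +ᶠ ψ) i j ≡ colDiff φ i j ℤ.+ colDiff ψ i j
  colDiff-+ = Δ-+ (φ (ver (suc (toℕ i)) j)) (ψ (ver (suc (toℕ i)) j)) (φ (ver (toℕ i) j)) (ψ (ver (toℕ i) j))

  rowDiff-− : rowDiff (φ -ᶠ ψ) i j ≡ rowDiff φ i j ℤ.- rowDiff ψ i j
  rowDiff-− = Δ-− (φ (hor i (suc (toℕ j)))) (ψ (hor i (suc (toℕ j)))) (φ (hor i (toℕ j))) (ψ (hor i (toℕ j)))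

  colDiff-− : colDiff (φ -ᶠ ψ) i j ≡ colDiff φ i j ℤ.- colDiff ψ i j
  colDiff-− = Δ-− (φ (ver (suc (toℕ i)) j)) (ψ (ver (suc (toℕ i)) j)) (φ (ver (toℕ i) j)) (ψ (ver (toℕ i) j))

module _ {n : ℕ} (φ : Flow n) (i j : Fin n) where
  private
    Δ-neg : ∀ a b → - a ℤ.- - b ≡ - (a ℤ.- b)
    Δ-neg = solve-∀

  rowDiff-neg : rowDiff (-ᶠ φ) i j ≡ - rowDiff φ i j
  rowDiff-neg = Δ-neg (φ (hor i (suc (toℕ j)))) (φ (hor i (toℕ j)))

  colDiff-neg : colDiff (-ᶠ φ) i j ≡ - colDiff φ i j
  colDiff-neg = Δ-neg (φ (ver (suc (toℕ i)) j)) (φ (ver (toℕ i) j))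

module _ {n} {A B : Matrix n} {η θ : Flow n} (hA : IsHeightFunction A η) (hB : IsHeightFunction B θ) where
  private
    module A = IsHeightFunction hA
    module B = IsHeightFunction hB

  rowDiff-difference : ∀ i j → rowDiff (θ -ᶠ η) i j ≡ B i j ℤ.- A i j
  rowDiff-difference i j = trans (rowDiff-− θ η i j) (cong₂ ℤ._-_ (B.rowDiff≡ i j) (A.rowDiff≡ i j))

  colDiff-difference : ∀ i j → colDiff (θ -ᶠ η) i j ≡ B i j ℤ.- A i j
  colDiff-difference i j = trans (colDiff-− θ η i j) (cong₂ ℤ._-_ (B.colDiff≡ i j) (A.colDiff≡ i j))

  difference-isCirculation : IsCirculation (θ -ᶠ η)
  difference-isCirculation = record
    { left      = λ i → cong₂ ℤ._-_ (B.left i) (A.left i)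
    ; right     = λ i → cong₂ ℤ._-_ (B.right i) (A.right i)
    ; top       = λ j → cong₂ ℤ._-_ (B.top j) (A.top j)
    ; bottom    = λ j → cong₂ ℤ._-_ (B.bottom j) (A.bottom j)
    ; conserved = λ i j → trans (rowDiff-difference i j) (sym (colDiff-difference i j))
    }

heightFunction-+ : ∀ {n} {M : Matrix n} {η φ : Flow n} → IsHeightFunction M η →
  IsCirculation φ → (∀ e → Bit (η e ℤ.+ φ e)) → IsHeightFunction (M +ᴹ rowDiff φ) (η +ᶠ φ)
heightFunction-+ {M = M} {η} {φ} hM circ bit = record
  { bit      = bit
  ; left     = λ i → cong₂ ℤ._+_ (H.left i) (C.left i)
  ; right    = λ i → cong₂ ℤ._+_ (H.right i) (C.right i)
  ; top      = λ j → cong₂ ℤ._+_ (H.top j) (C.top j)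
  ; bottom   = λ j → cong₂ ℤ._+_ (H.bottom j) (C.bottom j)
  ; rowDiff≡ = λ i j → trans (rowDiff-+ η φ i j) (cong (ℤ._+ rowDiff φ i j) (H.rowDiff≡ i j))
  ; colDiff≡ = λ i j → trans (colDiff-+ η φ i j) (cong₂ ℤ._+_ (H.colDiff≡ i j) (sym (C.conserved i j)))
  }
  where
  module H = IsHeightFunction hM
  module C = IsCirculation circ

circulation-neg : ∀ {n} {φ : Flow n} → IsCirculation φ → IsCirculation (-ᶠ φ)
circulation-neg {φ = φ} circ = record
  { left      = λ i → cong -_ (left i)
  ; right     = λ i → cong -_ (right i)
  ; top       = λ j → cong -_ (top j)
  ; bottom    = λ j → cong -_ (bottom j)
  ; conserved = λ i j → trans (rowDiff-neg φ i j) (trans (cong -_ (conserved i j)) (sym (colDiff-neg φ i j)))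
  }
  where open IsCirculation circ

-- Moving along grid edges

-- A direction is the pair (horizontal?, towards the larger index?).
Dir : Set
Dir = Bool × Bool

pattern R = true  , true
pattern L = true  , false
pattern D = false , true
pattern U = false , false

isHorizontal : Dir → Bool
isHorizontal = proj₁

opp : Dir → Dir
opp (h , b) = h , not b

_≟ᵈ_ : DecidableEquality Dir
_≟ᵈ_ = Σₚ.≡-dec Boolₚ._≟_ Boolₚ._≟_

Move : ∀ {n} → Vertex n → Dir → Vertex n → Set
Move (i , j) R (i' , j') = i ≡ i' × toℕ j' ≡ suc (toℕ j)
Move (i , j) L (i' , j') = i ≡ i' × suc (toℕ j') ≡ toℕ j
Move (i , j) D (i' , j') = j ≡ j' × toℕ i' ≡ suc (toℕ i)
Move (i , j) U (i' , j') = j ≡ j' × suc (toℕ i') ≡ toℕ i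

private
  n≢1+n : ∀ {m} → suc m ≢ m
  n≢1+n ()

  no-2-cycle : ∀ {m k} → k ≡ suc m → suc k ≡ m → ⊥
  no-2-cycle refl ()

move-opp : ∀ {n} {u w : Vertex n} d → Move u d w → Move w (opp d) u
move-opp {u = _ , _} {_ , _} R (p , q) = sym p , sym q
move-opp {u = _ , _} {_ , _} L (p , q) = sym p , sym q
move-opp {u = _ , _} {_ , _} D (p , q) = sym p , sym q
move-opp {u = _ , _} {_ , _} U (p , q) = sym p , sym q

move-irreflexive : ∀ {n} {u : Vertex n} d → ¬ Move u d u
move-irreflexive {u = _ , _} R (_ , q) = n≢1+n (sym q)
move-irreflexive {u = _ , _} L (_ , q) = n≢1+n q
move-irreflexive {u = _ , _} D (_ , q) = n≢1+n (sym q)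
move-irreflexive {u = _ , _} U (_ , q) = n≢1+n q

move-target-unique : ∀ {n} {u w w' : Vertex n} d → Move u d w → Move u d w' → w ≡ w'
move-target-unique {u = i , _} {_ , _} {_ , _} R (refl , q) (refl , q') =
  cong (i ,_) (Finₚ.toℕ-injective (trans q (sym q')))
move-target-unique {u = i , _} {_ , _} {_ , _} L (refl , q) (refl , q') =
  cong (i ,_) (Finₚ.toℕ-injective (ℕₚ.suc-injective (trans q (sym q'))))
move-target-unique {u = _ , j} {_ , _} {_ , _} D (refl , q) (refl , q') =
  cong (_, j) (Finₚ.toℕ-injective (trans q (sym q')))
move-target-unique {u = _ , j} {_ , _} {_ , _} U (refl , q) (refl , q') =
  cong (_, j) (Finₚ.toℕ-injective (ℕₚ.suc-injective (trans q (sym q'))))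

move-direction-unique : ∀ {n} {u w : Vertex n} d d' → Move u d w → Move u d' w → d ≡ d'
move-direction-unique R R _ _ = refl
move-direction-unique L L _ _ = refl
move-direction-unique D D _ _ = refl
move-direction-unique U U _ _ = refl
move-direction-unique {u = _ , _} {_ , _} R L (_ , q) (_ , q') = ⊥-elim (no-2-cycle q q')
move-direction-unique {u = _ , _} {_ , _} L R (_ , q) (_ , q') = ⊥-elim (no-2-cycle q' q)
move-direction-unique {u = _ , _} {_ , _} D U (_ , q) (_ , q') = ⊥-elim (no-2-cycle q q')
move-direction-unique {u = _ , _} {_ , _} U D (_ , q) (_ , q') = ⊥-elim (no-2-cycle q' q)
move-direction-unique {u = _ , _} {_ , _} R D (refl , _) (_ , q) = ⊥-elim (n≢1+n (sym q))
move-direction-unique {u = _ , _} {_ , _} R U (refl , _) (_ , q) = ⊥-elim (n≢1+n q)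
move-direction-unique {u = _ , _} {_ , _} L D (refl , _) (_ , q) = ⊥-elim (n≢1+n (sym q))
move-direction-unique {u = _ , _} {_ , _} L U (refl , _) (_ , q) = ⊥-elim (n≢1+n q)
move-direction-unique {u = _ , _} {_ , _} D R (refl , _) (_ , q) = ⊥-elim (n≢1+n (sym q))
move-direction-unique {u = _ , _} {_ , _} D L (refl , _) (_ , q) = ⊥-elim (n≢1+n q)
move-direction-unique {u = _ , _} {_ , _} U R (refl , _) (_ , q) = ⊥-elim (n≢1+n (sym q))
move-direction-unique {u = _ , _} {_ , _} U L (refl , _) (_ , q) = ⊥-elim (n≢1+n q)

move⇒HEdge : ∀ {n} {u w : Vertex n} {d} → Move u d w → isHorizontal d ≡ true → HEdge u w
move⇒HEdge {u = _ , _} {_ , _} {R} (p , q) _ = p , inj₁ (sym q)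
move⇒HEdge {u = _ , _} {_ , _} {L} (p , q) _ = p , inj₂ q

move⇒VEdge : ∀ {n} {u w : Vertex n} {d} → Move u d w → isHorizontal d ≡ false → VEdge u w
move⇒VEdge {u = _ , _} {_ , _} {D} (p , q) _ = p , inj₁ (sym q)
move⇒VEdge {u = _ , _} {_ , _} {U} (p , q) _ = p , inj₂ q

move⇒GridAdj : ∀ {n} {u w : Vertex n} {d} → Move u d w → GridAdj u w
move⇒GridAdj {d = true  , _} m = inj₁ (move⇒HEdge m refl)
move⇒GridAdj {d = false , _} m = inj₂ (move⇒VEdge m refl)

HEdge⇒¬VEdge : ∀ {n} {u w : Vertex n} → HEdge u w → ¬ VEdge u w
HEdge⇒¬VEdge {u = _ , _} {_ , _} (refl , inj₁ p) (refl , _) = n≢1+n p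
HEdge⇒¬VEdge {u = _ , _} {_ , _} (refl , inj₂ p) (refl , _) = n≢1+n p

move-HEdge⇒horizontal : ∀ {n} {u w : Vertex n} {d} → Move u d w → HEdge u w → isHorizontal d ≡ true
move-HEdge⇒horizontal {d = true  , _} _ _ = refl
move-HEdge⇒horizontal {d = false , _} m e = ⊥-elim (HEdge⇒¬VEdge e (move⇒VEdge m refl))

move-VEdge⇒vertical : ∀ {n} {u w : Vertex n} {d} → Move u d w → VEdge u w → isHorizontal d ≡ false
move-VEdge⇒vertical {d = false , _} _ _ = refl
move-VEdge⇒vertical {d = true  , _} m e = ⊥-elim (HEdge⇒¬VEdge (move⇒HEdge m refl) e)

edgeAt : ∀ {n} → Vertex n → Dir → Edge n
edgeAt (i , j) R = hor i (suc (toℕ j))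
edgeAt (i , j) L = hor i (toℕ j)
edgeAt (i , j) D = ver (suc (toℕ i)) j
edgeAt (i , j) U = ver (toℕ i) j

private
  hor-injective : ∀ {n} {i i' : Fin n} {j j'} → (Edge n ∋ hor i j) ≡ hor i' j' → i ≡ i' × j ≡ j'
  hor-injective refl = refl , refl

  ver-injective : ∀ {n} {i i'} {j j' : Fin n} → (Edge n ∋ ver i j) ≡ ver i' j' → i ≡ i' × j ≡ j'
  ver-injective refl = refl , refl

edgeAt-opp : ∀ {n} {u w : Vertex n} d → Move u d w → edgeAt w (opp d) ≡ edgeAt u d
edgeAt-opp {u = i , _} {_ , _} R (refl , q) = cong (hor i) q
edgeAt-opp {u = i , _} {_ , _} L (refl , q) = cong (hor i) q
edgeAt-opp {u = _ , j} {_ , _} D (refl , q) = cong (λ k → ver k j) q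
edgeAt-opp {u = _ , j} {_ , _} U (refl , q) = cong (λ k → ver k j) q

edgeAt-≡ : ∀ {n} {u w : Vertex n} d d' → edgeAt u d ≡ edgeAt w d' →
  (u ≡ w × d ≡ d') ⊎ (Move u d w × d' ≡ opp d)
edgeAt-≡ {u = i , _} {_ , _} R R eq with hor-injective eq
... | refl , q = inj₁ (cong (i ,_) (Finₚ.toℕ-injective (ℕₚ.suc-injective q)) , refl)
edgeAt-≡ {u = i , _} {_ , _} L L eq with hor-injective eq
... | refl , q = inj₁ (cong (i ,_) (Finₚ.toℕ-injective q) , refl)
edgeAt-≡ {u = _ , j} {_ , _} D D eq with ver-injective eq
... | q , refl = inj₁ (cong (_, j) (Finₚ.toℕ-injective (ℕₚ.suc-injective q)) , refl)
edgeAt-≡ {u = _ , j} {_ , _} U U eq with ver-injective eq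
... | q , refl = inj₁ (cong (_, j) (Finₚ.toℕ-injective q) , refl)
edgeAt-≡ {u = _ , _} {_ , _} R L eq with hor-injective eq
... | p , q = inj₂ ((p , sym q) , refl)
edgeAt-≡ {u = _ , _} {_ , _} L R eq with hor-injective eq
... | p , q = inj₂ ((p , sym q) , refl)
edgeAt-≡ {u = _ , _} {_ , _} D U eq with ver-injective eq
... | q , p = inj₂ ((p , sym q) , refl)
edgeAt-≡ {u = _ , _} {_ , _} U D eq with ver-injective eq
... | q , p = inj₂ ((p , sym q) , refl)
edgeAt-≡ {u = _ , _} {_ , _} R D ()
edgeAt-≡ {u = _ , _} {_ , _} R U ()
edgeAt-≡ {u = _ , _} {_ , _} L D ()
edgeAt-≡ {u = _ , _} {_ , _} L U ()
edgeAt-≡ {u = _ , _} {_ , _} D R ()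
edgeAt-≡ {u = _ , _} {_ , _} D L ()
edgeAt-≡ {u = _ , _} {_ , _} U R ()
edgeAt-≡ {u = _ , _} {_ , _} U L ()

-- Signs chosen so that the conservation law rowDiff φ ≡ colDiff φ says that the
-- outflows at every vertex add up to zero.
orient : Dir → ℤ → ℤ
orient R x = x
orient L x = - x
orient D x = - x
orient U x = x

orient-opp : ∀ d x → orient (opp d) x ≡ - orient d x
orient-opp R x = refl
orient-opp L x = sym (ℤₚ.neg-involutive x)
orient-opp D x = sym (ℤₚ.neg-involutive x)
orient-opp U x = refl

orient-0 : ∀ d → orient d (+ 0) ≡ + 0
orient-0 R = refl
orient-0 L = refl
orient-0 D = refl
orient-0 U = refl

orient-trit : ∀ d {x} → Trit x → Trit (orient d x)
orient-trit R t = t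
orient-trit L t = trit-neg t
orient-trit D t = trit-neg t
orient-trit U t = t

outflow : ∀ {n} → Flow n → Dir → Vertex n → ℤ
outflow φ d u = orient d (φ (edgeAt u d))

outflow-opp : ∀ {n} (φ : Flow n) {u w : Vertex n} d → Move u d w → outflow φ (opp d) w ≡ - outflow φ d u
outflow-opp φ d m = trans (cong (orient (opp d) ∘ φ) (edgeAt-opp d m)) (orient-opp d _)

sumDir : (Dir → ℤ) → ℤ
sumDir f = f R ℤ.+ f L ℤ.+ f D ℤ.+ f U

outflow-total : ∀ {n} (φ : Flow n) i j →
  sumDir (λ d → outflow φ d (i , j)) ≡ rowDiff φ i j ℤ.- colDiff φ i j
outflow-total φ i j =
  regroup (φ (hor i (suc (toℕ j)))) (φ (hor i (toℕ j))) (φ (ver (suc (toℕ i)) j)) (φ (ver (toℕ i) j))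
  where
  regroup : ∀ a b c d → a ℤ.+ - b ℤ.+ - c ℤ.+ d ≡ (a ℤ.- b) ℤ.- (c ℤ.- d)
  regroup = solve-∀

conserved⇔outflow-total≡0 : ∀ {n} (φ : Flow n) i j →
  (rowDiff φ i j ≡ colDiff φ i j) ⇔ (sumDir (λ d → outflow φ d (i , j)) ≡ + 0)
conserved⇔outflow-total≡0 φ i j = mk⇔
  (λ eq → trans (outflow-total φ i j) (ℤₚ.i≡j⇒i-j≡0 eq))
  (λ eq → ℤₚ.i-j≡0⇒i≡j _ _ (trans (sym (outflow-total φ i j)) eq))

outflow≢0⇒move : ∀ {n} {φ : Flow n} → IsCirculation φ → ∀ d u → outflow φ d u ≢ + 0 → Σ (Vertex n) (Move u d)
outflow≢0⇒move {n} {φ} c R (i , j) nz with suc (toℕ j) ℕ.≟ n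
... | yes j+1≡n = ⊥-elim (nz (trans (cong (φ ∘ hor i) j+1≡n) (IsCirculation.right c i)))
... | no  j+1≢n = (i , fromℕ< (ℕₚ.≤∧≢⇒< (Finₚ.toℕ<n j) j+1≢n)) , refl , Finₚ.toℕ-fromℕ< _
outflow≢0⇒move c L (i , Fin.zero) nz = ⊥-elim (nz (cong -_ (IsCirculation.left c i)))
outflow≢0⇒move c L (i , Fin.suc j) nz = (i , Fin.inject₁ j) , refl , cong suc (Finₚ.toℕ-inject₁ j)
outflow≢0⇒move {n} {φ} c D (i , j) nz with suc (toℕ i) ℕ.≟ n
... | yes i+1≡n = ⊥-elim (nz (cong -_ (trans (cong (λ k → φ (ver k j)) i+1≡n) (IsCirculation.bottom c j))))
... | no  i+1≢n = (fromℕ< (ℕₚ.≤∧≢⇒< (Finₚ.toℕ<n i) i+1≢n) , j) , refl , Finₚ.toℕ-fromℕ< _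
outflow≢0⇒move c U (Fin.zero , j) nz = ⊥-elim (nz (IsCirculation.top c j))
outflow≢0⇒move c U (Fin.suc i , j) nz = (Fin.inject₁ i , j) , refl , cong suc (Finₚ.toℕ-inject₁ i)

rowDiff≡0⇒outflow≡0 : ∀ {n} {ψ : Flow n} → IsCirculation ψ → (∀ i j → rowDiff ψ i j ≡ + 0) →
  ∀ d u → outflow ψ d u ≡ + 0
rowDiff≡0⇒outflow≡0 {n} {ψ} circ rowDiff≡0 d u = trans (cong (orient d) (edge-zero d u)) (orient-0 d)
  where
  open IsCirculation circ
  hor-zero : ∀ i j → j ≤ n → ψ (hor i j) ≡ + 0
  hor-zero i j j≤n = trans (constant-on-≤ (λ j → ψ (hor i j))
    (λ j → ℤₚ.i-j≡0⇒i≡j _ _ (rowDiff≡0 i j)) j j≤n) (left i)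
  ver-zero : ∀ i j → i ≤ n → ψ (ver i j) ≡ + 0
  ver-zero i j i≤n = trans (constant-on-≤ (λ i → ψ (ver i j))
    (λ i → ℤₚ.i-j≡0⇒i≡j _ _ (trans (sym (conserved i j)) (rowDiff≡0 i j))) i i≤n) (top j)
  edge-zero : ∀ d u → ψ (edgeAt u d) ≡ + 0
  edge-zero R (i , j) = hor-zero i _ (Finₚ.toℕ<n j)
  edge-zero L (i , j) = hor-zero i _ (Finₚ.toℕ≤n j)
  edge-zero D (i , j) = ver-zero _ j (Finₚ.toℕ<n i)
  edge-zero U (i , j) = ver-zero _ j (Finₚ.toℕ≤n i)

-- Unit circulations contain simple cycles

InjectiveBelow : ∀ {A : Set} → (ℕ → A) → ℕ → Set
InjectiveBelow w m = ∀ {s t} → s < m → t < m → w s ≡ w t → s ≡ t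

record Loop {A : Set} (w : ℕ → A) : Set where
  field
    start period : ℕ
    nonempty     : 0 < period
    closes       : w (start + period) ≡ w start
    injective    : ∀ {s t} → s < period → t < period → w (start + s) ≡ w (start + t) → s ≡ t

module _ {A : Set} (_≟_ : DecidableEquality A) (w : ℕ → A) where

  private
    loop-back : ∀ {m} s → s < m → w s ≡ w m → InjectiveBelow w m → Loop w
    loop-back {m} s s<m ws≡wm inj = record
      { start     = s
      ; period    = m ∸ s
      ; nonempty  = ℕₚ.m<n⇒0<n∸m s<m
      ; closes    = trans (cong w s+[m∸s]≡m) (sym ws≡wm)
      ; injective = λ s' t' eq → ℕₚ.+-cancelˡ-≡ s _ _ (inj (shifted s') (shifted t') eq)
      }
      where
      s+[m∸s]≡m : s + (m ∸ s) ≡ m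
      s+[m∸s]≡m = ℕₚ.m+[n∸m]≡n (ℕₚ.<⇒≤ s<m)
      shifted : ∀ {x} → x < m ∸ s → s + x < m
      shifted x< = subst (s + _ <_) s+[m∸s]≡m (ℕₚ.+-monoʳ-< s x<)

    extend : ∀ {m} → InjectiveBelow w m → (∀ (s : Fin m) → w (toℕ s) ≢ w m) →
      InjectiveBelow w (suc m)
    extend inj fresh s<1+m t<1+m eq
      with ℕₚ.m<1+n⇒m<n∨m≡n s<1+m | ℕₚ.m<1+n⇒m<n∨m≡n t<1+m
    ... | inj₁ s<m  | inj₁ t<m  = inj s<m t<m eq
    ... | inj₁ s<m  | inj₂ refl = ⊥-elim (fresh (fromℕ< s<m) (trans (cong w (Finₚ.toℕ-fromℕ< s<m)) eq))
    ... | inj₂ refl | inj₁ t<m  = ⊥-elim (fresh (fromℕ< t<m) (trans (cong w (Finₚ.toℕ-fromℕ< t<m)) (sym eq)))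
    ... | inj₂ refl | inj₂ refl = refl

  injectiveBelow-or-loop : ∀ m → InjectiveBelow w m ⊎ Loop w
  injectiveBelow-or-loop zero = inj₁ λ ()
  injectiveBelow-or-loop (suc m) with injectiveBelow-or-loop m
  ... | inj₂ l   = inj₂ l
  ... | inj₁ inj with Finₚ.any? (λ (s : Fin m) → w (toℕ s) ≟ w m)
  ...   | yes (s , ws≡wm) = inj₂ (loop-back (toℕ s) (Finₚ.toℕ<n s) ws≡wm inj)
  ...   | no  ∄s          = inj₁ (extend inj (λ s eq → ∄s (s , eq)))

loop : ∀ {A : Set} {N} → DecidableEquality A → (enc : A → Fin N) →
  (∀ {x y} → enc x ≡ enc y → x ≡ y) → (w : ℕ → A) → Loop w
loop {N = N} _≟_ enc enc-injective w with injectiveBelow-or-loop _≟_ w (suc N)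
... | inj₂ l   = l
... | inj₁ inj with Finₚ.pigeonhole (ℕₚ.n<1+n N) (enc ∘ w ∘ toℕ)
...   | s , t , s<t , eq =
  ⊥-elim (ℕₚ.<-irrefl (inj (Finₚ.toℕ<n s) (Finₚ.toℕ<n t) (enc-injective eq)) s<t)

module _ {m : ℕ} .{{_ : NonZero m}} where

  toℕ-cshift : ∀ (k : Fin m) d → toℕ (cshift k d) ≡ (toℕ k + d) % m
  toℕ-cshift k d = Finₚ.toℕ-fromℕ< _

  cshift-+ : ∀ (k : Fin m) a b → cshift (cshift k a) b ≡ cshift k (a + b)
  cshift-+ k a b = Finₚ.toℕ-injective (begin
    toℕ (cshift (cshift k a) b)            ≡⟨ toℕ-cshift (cshift k a) b ⟩
    (toℕ (cshift k a) + b) % m             ≡⟨ cong (λ x → (x + b) % m) (toℕ-cshift k a) ⟩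
    ((toℕ k + a) % m + b) % m              ≡⟨ %-distribˡ-+ ((toℕ k + a) % m) b m ⟩
    ((toℕ k + a) % m % m + b % m) % m      ≡⟨ cong (λ x → (x + b % m) % m) (m%n%n≡m%n (toℕ k + a) m) ⟩
    ((toℕ k + a) % m + b % m) % m          ≡⟨ %-distribˡ-+ (toℕ k + a) b m ⟨
    (toℕ k + a + b) % m                    ≡⟨ cong (_% m) (ℕₚ.+-assoc (toℕ k) a b) ⟩
    (toℕ k + (a + b)) % m                  ≡⟨ toℕ-cshift k (a + b) ⟨
    toℕ (cshift k (a + b))                 ∎)
    where open ≡-Reasoning

  toℕ-next : ∀ (k : Fin m) → toℕ (cshift k 1) ≡ suc (toℕ k) % m
  toℕ-next k = trans (toℕ-cshift k 1) (cong (_% m) (ℕₚ.+-comm (toℕ k) 1))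

  cshift-period : ∀ (k : Fin m) → cshift k m ≡ k
  cshift-period k = Finₚ.toℕ-injective
    (trans (toℕ-cshift k m) (trans ([m+n]%n≡m%n (toℕ k) m) (m<n⇒m%n≡m (Finₚ.toℕ<n k))))

  cshift-cancel : ∀ (k : Fin m) a b → a + b ≡ m → cshift (cshift k a) b ≡ k
  cshift-cancel k a b a+b≡m = trans (cshift-+ k a b) (trans (cong (cshift k) a+b≡m) (cshift-period k))

  toℕ-cshift-1 : ∀ (k : Fin m) →
    (suc (toℕ k) < m × toℕ (cshift k 1) ≡ suc (toℕ k)) ⊎ (suc (toℕ k) ≡ m × toℕ (cshift k 1) ≡ 0)
  toℕ-cshift-1 k with ℕₚ.m≤n⇒m<n∨m≡n (Finₚ.toℕ<n k)
  ... | inj₁ k+1<m  = inj₁ (k+1<m , trans (toℕ-next k) (m<n⇒m%n≡m k+1<m))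
  ... | inj₂ k+1≡m  = inj₂ (k+1≡m , trans (toℕ-next k) (trans (cong (_% m) k+1≡m) (n%n≡0 m)))

  cshift-0 : ∀ (k : Fin m) → cshift k 0 ≡ k
  cshift-0 k = Finₚ.toℕ-injective
    (trans (toℕ-cshift k 0) (trans (cong (_% m) (ℕₚ.+-identityʳ (toℕ k))) (m<n⇒m%n≡m (Finₚ.toℕ<n k))))

private
  ∃Bool? : ∀ {Q : Bool → Set} → (∀ b → Dec (Q b)) → Dec (Σ Bool Q)
  ∃Bool? Q? = map′ [ (true ,_) , (false ,_) ] (λ { (true , q) → inj₁ q ; (false , q) → inj₂ q })
                   (Q? true ⊎-dec Q? false)

∃Dir? : ∀ {P : Dir → Set} → (∀ d → Dec (P d)) → Dec (Σ Dir P)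
∃Dir? P? = map′ (λ (a , b , p) → (a , b) , p) (λ ((a , b) , p) → a , b , p)
                (∃Bool? λ a → ∃Bool? λ b → P? (a , b))

nonpositive-+≡0ˡ : ∀ {a b} → a ℤ.≤ + 0 → b ℤ.≤ + 0 → a ℤ.+ b ≡ + 0 → a ≡ + 0
nonpositive-+≡0ˡ {a} {b} a≤0 b≤0 a+b≡0 = ℤₚ.≤-antisym a≤0 (begin
  + 0          ≡⟨ a+b≡0 ⟨
  a ℤ.+ b      ≤⟨ ℤₚ.+-monoʳ-≤ a b≤0 ⟩
  a ℤ.+ + 0    ≡⟨ ℤₚ.+-identityʳ a ⟩
  a            ∎)
  where open ℤₚ.≤-Reasoning

nonpositive-+≡0 : ∀ {a b} → a ℤ.≤ + 0 → b ℤ.≤ + 0 → a ℤ.+ b ≡ + 0 → a ≡ + 0 × b ≡ + 0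
nonpositive-+≡0 {a} {b} a≤0 b≤0 a+b≡0 =
  nonpositive-+≡0ˡ a≤0 b≤0 a+b≡0 , nonpositive-+≡0ˡ b≤0 a≤0 (trans (ℤₚ.+-comm b a) a+b≡0)

nonpositive-sumDir≡0 : ∀ (f : Dir → ℤ) → (∀ d → f d ℤ.≤ + 0) → sumDir f ≡ + 0 → ∀ d → f d ≡ + 0
nonpositive-sumDir≡0 f f≤0 total
  with nonpositive-+≡0 (ℤₚ.+-mono-≤ (ℤₚ.+-mono-≤ (f≤0 R) (f≤0 L)) (f≤0 D)) (f≤0 U) total
... | RLD≡0 , U≡0 with nonpositive-+≡0 (ℤₚ.+-mono-≤ (f≤0 R) (f≤0 L)) (f≤0 D) RLD≡0
... | RL≡0 , D≡0 with nonpositive-+≡0 (f≤0 R) (f≤0 L) RL≡0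
... | R≡0 , L≡0 = λ { R → R≡0 ; L → L≡0 ; D → D≡0 ; U → U≡0 }

trit≢1⇒≤0 : ∀ {x} → Trit x → x ≢ + 1 → x ℤ.≤ + 0
trit≢1⇒≤0 trit0  _   = +≤+ z≤n
trit≢1⇒≤0 trit+1 x≢1 = ⊥-elim (x≢1 refl)
trit≢1⇒≤0 trit-1 _   = -≤+

record FlowCycle {n} (φ : Flow n) : Set where
  field
    cycle   : SimpleCycle n
    dir     : Fin (len cycle) → Dir
    moves   : ∀ k → Move (v cycle k) (dir k) (v cycle (next cycle k))
    carries : ∀ k → outflow φ (dir k) (v cycle k) ≡ + 1

module UnitCirculation {n : ℕ} {φ : Flow n} (circ : IsCirculation φ) (trit : ∀ e → Trit (φ e)) where

  HasOut : Vertex n → Set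
  HasOut u = Σ Dir λ d → outflow φ d u ≡ + 1

  hasOut? : ∀ u → Dec (HasOut u)
  hasOut? u = ∃Dir? λ d → outflow φ d u ℤ.≟ + 1

  outflow-trit : ∀ d u → Trit (outflow φ d u)
  outflow-trit d u = orient-trit d (trit (edgeAt u d))

  inflow⇒hasOut : ∀ {d u} → outflow φ d u ≡ - + 1 → HasOut u
  inflow⇒hasOut {d} {u@(i , j)} inflow with hasOut? u
  ... | yes h = h
  ... | no ∄h = ⊥-elim (-1≢0 (trans (sym inflow) (nonpositive-sumDir≡0 (λ d → outflow φ d u)
                  (λ d' → trit≢1⇒≤0 (outflow-trit d' u) (λ eq → ∄h (d' , eq)))
                  (Equivalence.to (conserved⇔outflow-total≡0 φ i j) (IsCirculation.conserved circ i j)) d)))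
    where
    -1≢0 : - + 1 ≢ + 0
    -1≢0 ()

  outflow≢0⇒hasOut : ∀ {d u} → outflow φ d u ≢ + 0 → HasOut u
  outflow≢0⇒hasOut {d} {u} nz with trit⇒entry (outflow-trit d u)
  ... | inj₁ ≡0          = ⊥-elim (nz ≡0)
  ... | inj₂ (inj₁ ≡1)   = d , ≡1
  ... | inj₂ (inj₂ ≡-1)  = inflow⇒hasOut {d} ≡-1

  private
    1≢0 : ∀ {x} → x ≡ + 1 → x ≢ + 0
    1≢0 refl ()

  step : Vertex n → Vertex n
  step u with hasOut? u
  ... | yes (d , ≡1) = proj₁ (outflow≢0⇒move circ d u (1≢0 ≡1))
  ... | no  _        = u

  step-move : ∀ {u} → HasOut u → Σ Dir λ d → Move u d (step u) × outflow φ d u ≡ + 1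
  step-move {u} h with hasOut? u
  ... | yes (d , ≡1) = d , proj₂ (outflow≢0⇒move circ d u (1≢0 ≡1)) , ≡1
  ... | no  ∄h       = ⊥-elim (∄h h)

  hasOut-step : ∀ {u} → HasOut u → HasOut (step u)
  hasOut-step h with step-move h
  ... | d , m , ≡1 = inflow⇒hasOut {opp d} (trans (outflow-opp φ d m) (cong -_ ≡1))

  step-irreflexive : ∀ {u} → HasOut u → step u ≢ u
  step-irreflexive h eq with step-move h
  ... | d , m , _ = move-irreflexive d (subst (Move _ d) eq m)

  no-backtrack : ∀ {u} → HasOut u → step (step u) ≢ u
  no-backtrack {u} h eq with step-move h | step-move (hasOut-step h)
  ... | d , m , ≡1 | d' , m' , ≡1' = 1≢-1 (begin
    + 1                          ≡⟨ ≡1' ⟨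
    outflow φ d' (step u)        ≡⟨ cong (λ d'' → outflow φ d'' (step u)) d'≡opp-d ⟩
    outflow φ (opp d) (step u)   ≡⟨ outflow-opp φ d m ⟩
    - outflow φ d u              ≡⟨ cong -_ ≡1 ⟩
    - + 1                        ∎)
    where
    open ≡-Reasoning
    d'≡opp-d : d' ≡ opp d
    d'≡opp-d = move-direction-unique d' (opp d) (subst (Move (step u) d') eq m') (move-opp d m)
    1≢-1 : + 1 ≢ - + 1
    1≢-1 ()

  walk : Vertex n → ℕ → Vertex n
  walk u zero    = u
  walk u (suc k) = step (walk u k)

  walk-hasOut : ∀ {u} → HasOut u → ∀ k → HasOut (walk u k)
  walk-hasOut h zero    = h
  walk-hasOut h (suc k) = hasOut-step (walk-hasOut h k)

  loop⇒flowCycle : ∀ {u} → HasOut u → Loop (walk u) → FlowCycle φ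
  loop⇒flowCycle {u} h l = around period nonempty closes′ injective
    where
    open Loop l
    W : ℕ → Vertex n
    W k = walk u (start + k)
    W-suc : ∀ k → W (suc k) ≡ step (W k)
    W-suc k = cong (walk u) (ℕₚ.+-suc start k)
    hasOut-W : ∀ k → HasOut (W k)
    hasOut-W k = walk-hasOut h (start + k)
    closes′ : W period ≡ W 0
    closes′ = trans closes (cong (walk u) (sym (ℕₚ.+-identityʳ start)))

    around : ∀ p → 0 < p → W p ≡ W 0 → (∀ {s t} → s < p → t < p → W s ≡ W t → s ≡ t) → FlowCycle φ
    around 1 _ W1≡W0 _ = ⊥-elim (step-irreflexive (hasOut-W 0) (trans (sym (W-suc 0)) W1≡W0))
    around 2 _ W2≡W0 _ =
      ⊥-elim (no-backtrack (hasOut-W 0) (trans (sym (trans (W-suc 1) (cong step (W-suc 0)))) W2≡W0))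
    around (suc (suc (suc m))) _ Wp≡W0 W-injective = record
      { cycle   = K
      ; dir     = λ k → proj₁ (step-move (hasOut-W (toℕ k)))
      ; moves   = λ k → subst (Move _ _) (sym (next-step k)) (proj₁ (proj₂ (step-move (hasOut-W (toℕ k)))))
      ; carries = λ k → proj₂ (proj₂ (step-move (hasOut-W (toℕ k))))
      }
      where
      vertex : Fin (suc (suc (suc m))) → Vertex n
      vertex k = W (toℕ k)
      next-step : ∀ k → vertex (cshift k 1) ≡ step (vertex k)
      next-step k with toℕ-cshift-1 k
      ... | inj₁ (_ , eq)      = trans (cong W eq) (W-suc (toℕ k))
      ... | inj₂ (k+1≡p , eq) = trans (cong W eq) (trans (sym Wp≡W0) (trans (cong W (sym k+1≡p)) (W-suc (toℕ k))))
      K : SimpleCycle n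
      K = record
        { r   = m
        ; v   = vertex
        ; inj = λ k l eq → Finₚ.toℕ-injective (W-injective (Finₚ.toℕ<n k) (Finₚ.toℕ<n l) eq)
        ; adj = λ k → subst (GridAdj (vertex k)) (sym (next-step k))
                        (move⇒GridAdj (proj₁ (proj₂ (step-move (hasOut-W (toℕ k))))))
        }

  flowCycle : ∀ {u} → HasOut u → FlowCycle φ
  flowCycle {u} h = loop⇒flowCycle h (loop (Σₚ.≡-dec Finₚ._≟_ Finₚ._≟_) encode encode-injective (walk u))
    where
    encode : Vertex n → Fin (n ℕ.* n)
    encode (i , j) = Fin.combine i j
    encode-injective : ∀ {x y} → encode x ≡ encode y → x ≡ y
    encode-injective {i , j} {k , l} eq with Finₚ.combine-injective i j k l eq
    ... | refl , refl = refl

-- The flow around a cycle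

restrict : ∀ {n} {P : Edge n → Set} → Decidable P → Flow n → Flow n
restrict P? φ e = if does (P? e) then φ e else + 0

module _ {n} {P : Edge n → Set} (P? : Decidable P) (φ : Flow n) where

  restrict-kept : ∀ {e} → P e → restrict P? φ e ≡ φ e
  restrict-kept {e} p rewrite dec-true (P? e) p = refl

  restrict-dropped : ∀ {e} → ¬ P e → restrict P? φ e ≡ + 0
  restrict-dropped {e} ¬p rewrite dec-false (P? e) ¬p = refl

  outflow-restrict-kept : ∀ {d u} → P (edgeAt u d) → outflow (restrict P? φ) d u ≡ outflow φ d u
  outflow-restrict-kept {d} p = cong (orient d) (restrict-kept p)

  outflow-restrict-dropped : ∀ {d u} → ¬ P (edgeAt u d) → outflow (restrict P? φ) d u ≡ + 0
  outflow-restrict-dropped {d} ¬p = trans (cong (orient d) (restrict-dropped ¬p)) (orient-0 d)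

  restrict-kept-or-dropped : ∀ e → (restrict P? φ e ≡ φ e) ⊎ (restrict P? φ e ≡ + 0)
  restrict-kept-or-dropped e with P? e
  ... | yes _ = inj₁ refl
  ... | no  _ = inj₂ refl

  restrict-zero : ∀ {e} → φ e ≡ + 0 → restrict P? φ e ≡ + 0
  restrict-zero {e} φe≡0 with does (P? e)
  ... | true  = φe≡0
  ... | false = refl

δ : Dir → Dir → ℤ
δ a d = if does (a ≟ᵈ d) then + 1 else + 0

δ-self : ∀ a → δ a a ≡ + 1
δ-self a rewrite dec-true (a ≟ᵈ a) refl = refl

δ-other : ∀ {a d} → a ≢ d → δ a d ≡ + 0
δ-other {a} {d} a≢d rewrite dec-false (a ≟ᵈ d) a≢d = refl

sumDir-δ : ∀ a → sumDir (δ a) ≡ + 1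
sumDir-δ R = refl
sumDir-δ L = refl
sumDir-δ D = refl
sumDir-δ U = refl

indicator : Bool → ℤ
indicator true  = + 1
indicator false = + 0

δ-horizontal : ∀ a → δ a R ℤ.+ δ a L ≡ indicator (isHorizontal a)
δ-horizontal R = refl
δ-horizontal L = refl
δ-horizontal D = refl
δ-horizontal U = refl

sumDir-cong : ∀ {f g : Dir → ℤ} → (∀ d → f d ≡ g d) → sumDir f ≡ sumDir g
sumDir-cong f≡g = cong₂ ℤ._+_ (cong₂ ℤ._+_ (cong₂ ℤ._+_ (f≡g R) (f≡g L)) (f≡g D)) (f≡g U)

sumDir-− : ∀ (f g : Dir → ℤ) → sumDir (λ d → f d ℤ.- g d) ≡ sumDir f ℤ.- sumDir g
sumDir-− f g = regroup (f R) (f L) (f D) (f U) (g R) (g L) (g D) (g U)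
  where
  regroup : ∀ a b c d a' b' c' d' →
    (a ℤ.- a') ℤ.+ (b ℤ.- b') ℤ.+ (c ℤ.- c') ℤ.+ (d ℤ.- d') ≡ (a ℤ.+ b ℤ.+ c ℤ.+ d) ℤ.- (a' ℤ.+ b' ℤ.+ c' ℤ.+ d')
  regroup = solve-∀

indicator-difference-entry : ∀ a b → Entry (indicator a ℤ.- indicator b)
indicator-difference-entry true  true  = inj₁ refl
indicator-difference-entry true  false = inj₂ (inj₁ refl)
indicator-difference-entry false true  = inj₂ (inj₂ refl)
indicator-difference-entry false false = inj₁ refl

indicator-difference≢0 : ∀ {a b} → indicator a ℤ.- indicator b ≢ + 0 → b ≡ not a
indicator-difference≢0 {true}  {true}  nz = ⊥-elim (nz refl)
indicator-difference≢0 {true}  {false} _  = refl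
indicator-difference≢0 {false} {true}  _  = refl
indicator-difference≢0 {false} {false} nz = ⊥-elim (nz refl)

indicator-turn≢0 : ∀ a → indicator a ℤ.- indicator (not a) ≢ + 0
indicator-turn≢0 true  ()
indicator-turn≢0 false ()

indicator-turn-neg : ∀ a → indicator (not a) ℤ.- indicator a ≡ - (indicator a ℤ.- indicator (not a))
indicator-turn-neg true  = refl
indicator-turn-neg false = refl

edge-≟ : ∀ {n} → DecidableEquality (Edge n)
edge-≟ = ⊎ₚ.≡-dec (Σₚ.≡-dec Finₚ._≟_ ℕₚ._≟_) (Σₚ.≡-dec ℕₚ._≟_ Finₚ._≟_)

module CycleFlow {n} {φ : Flow n} (K : FlowCycle φ) where

  open FlowCycle K public

  vertex : Fin (len cycle) → Vertex n
  vertex = v cycle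

  private
    len-1+1 : len cycle ∸ 1 + 1 ≡ len cycle
    len-1+1 = ℕₚ.+-comm (len cycle ∸ 1) 1

  next-prev : ∀ k → next cycle (prev cycle k) ≡ k
  next-prev k = cshift-cancel k (len cycle ∸ 1) 1 len-1+1

  prev-next : ∀ k → prev cycle (next cycle k) ≡ k
  prev-next k = cshift-cancel k 1 (len cycle ∸ 1) refl

  prev-cshift-suc : ∀ k e → prev cycle (cshift k (suc e)) ≡ cshift k e
  prev-cshift-suc k e = begin
    cshift (cshift k (suc e)) (len cycle ∸ 1)   ≡⟨ cshift-+ k (suc e) (len cycle ∸ 1) ⟩
    cshift k (suc e + (len cycle ∸ 1))          ≡⟨ cong (cshift k) (ℕₚ.+-suc e (len cycle ∸ 1)) ⟨
    cshift k (e + len cycle)                    ≡⟨ cshift-+ k e (len cycle) ⟨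
    cshift (cshift k e) (len cycle)             ≡⟨ cshift-period (cshift k e) ⟩
    cshift k e                                  ∎
    where open ≡-Reasoning

  inDir : Fin (len cycle) → Dir
  inDir k = opp (dir (prev cycle k))

  moves-in : ∀ k → Move (vertex (prev cycle k)) (dir (prev cycle k)) (vertex k)
  moves-in k = subst (Move _ _) (cong vertex (next-prev k)) (moves (prev cycle k))

  inflow : ∀ k → outflow φ (inDir k) (vertex k) ≡ - + 1
  inflow k = trans (outflow-opp φ (dir (prev cycle k)) (moves-in k)) (cong -_ (carries (prev cycle k)))

  dir≢inDir : ∀ k → dir k ≢ inDir k
  dir≢inDir k eq with () ← trans (sym (carries k)) (trans (cong (λ d → outflow φ d (vertex k)) eq) (inflow k))

  on-cycle? : ∀ u → Dec (Σ (Fin (len cycle)) λ k → vertex k ≡ u)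
  on-cycle? u = Finₚ.any? (λ k → Σₚ.≡-dec Finₚ._≟_ Finₚ._≟_ (vertex k) u)

  Used : Edge n → Set
  Used e = Σ (Fin (len cycle)) λ k → edgeAt (vertex k) (dir k) ≡ e

  used? : Decidable Used
  used? e = Finₚ.any? (λ k → edge-≟ (edgeAt (vertex k) (dir k)) e)

  used-out : ∀ k → Used (edgeAt (vertex k) (dir k))
  used-out k = k , refl

  used-in : ∀ k → Used (edgeAt (vertex k) (inDir k))
  used-in k = prev cycle k , sym (edgeAt-opp (dir (prev cycle k)) (moves-in k))

  used-at-cycle-vertex : ∀ k d → Used (edgeAt (vertex k) d) → d ≡ dir k ⊎ d ≡ inDir k
  used-at-cycle-vertex k d (m , eq) with edgeAt-≡ (dir m) d eq
  ... | inj₁ (vm≡vk , dm≡d) = inj₁ (trans (sym dm≡d) (cong dir (inj cycle m k vm≡vk)))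
  ... | inj₂ (move , d≡opp) = inj₂ (trans d≡opp (cong (opp ∘ dir) m≡prev-k))
    where
    m≡prev-k : m ≡ prev cycle k
    m≡prev-k = trans (sym (prev-next m))
      (cong (prev cycle) (inj cycle _ _ (move-target-unique (dir m) (moves m) move)))

  unused-off-cycle : ∀ {u} → (∀ k → vertex k ≢ u) → ∀ d → ¬ Used (edgeAt u d)
  unused-off-cycle off d (m , eq) with edgeAt-≡ (dir m) d eq
  ... | inj₁ (vm≡u , _) = off m vm≡u
  ... | inj₂ (move , _) = off (next cycle m) (move-target-unique (dir m) (moves m) move)

  ψ : Flow n
  ψ = restrict used? φ

  outflow-φ-along-cycle : ∀ k {d} → d ≡ dir k ⊎ d ≡ inDir k →
    outflow φ d (vertex k) ≡ δ (dir k) d ℤ.- δ (inDir k) d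
  outflow-φ-along-cycle k (inj₁ refl) = begin
    outflow φ (dir k) (vertex k)                   ≡⟨ carries k ⟩
    + 1                                            ≡⟨ cong₂ ℤ._-_ (δ-self (dir k)) (δ-other (dir≢inDir k ∘ sym)) ⟨
    δ (dir k) (dir k) ℤ.- δ (inDir k) (dir k)      ∎
    where open ≡-Reasoning
  outflow-φ-along-cycle k (inj₂ refl) = begin
    outflow φ (inDir k) (vertex k)                 ≡⟨ inflow k ⟩
    - + 1                                          ≡⟨ cong₂ ℤ._-_ (δ-other (dir≢inDir k)) (δ-self (inDir k)) ⟨
    δ (dir k) (inDir k) ℤ.- δ (inDir k) (inDir k)  ∎
    where open ≡-Reasoning

  outflow-ψ-at-cycle : ∀ k d → outflow ψ d (vertex k) ≡ δ (dir k) d ℤ.- δ (inDir k) d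
  outflow-ψ-at-cycle k d with used? (edgeAt (vertex k) d)
  ... | yes used = trans (outflow-restrict-kept used? φ used) (outflow-φ-along-cycle k (used-at-cycle-vertex k d used))
  ... | no unused = trans (outflow-restrict-dropped used? φ unused) (sym (cong₂ ℤ._-_
    (δ-other (λ eq → unused (subst (Used ∘ edgeAt (vertex k)) eq (used-out k))))
    (δ-other (λ eq → unused (subst (Used ∘ edgeAt (vertex k)) eq (used-in k))))))

  outflow-ψ-off-cycle : ∀ {u} → (∀ k → vertex k ≢ u) → ∀ d → outflow ψ d u ≡ + 0
  outflow-ψ-off-cycle off d = outflow-restrict-dropped used? φ (unused-off-cycle off d)

  outflow-total-ψ : ∀ u → sumDir (λ d → outflow ψ d u) ≡ + 0
  outflow-total-ψ u with on-cycle? u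
  ... | yes (k , refl) = begin
    sumDir (λ d → outflow ψ d (vertex k))                 ≡⟨ sumDir-cong (outflow-ψ-at-cycle k) ⟩
    sumDir (λ d → δ (dir k) d ℤ.- δ (inDir k) d)          ≡⟨ sumDir-− (δ (dir k)) (δ (inDir k)) ⟩
    sumDir (δ (dir k)) ℤ.- sumDir (δ (inDir k))           ≡⟨ cong₂ ℤ._-_ (sumDir-δ (dir k)) (sumDir-δ (inDir k)) ⟩
    + 0                                                   ∎
    where open ≡-Reasoning
  ... | no off = sumDir-cong (outflow-ψ-off-cycle (λ k eq → off (k , eq)))

  ψ-circulation : IsCirculation φ → IsCirculation ψ
  ψ-circulation circ = record
    { left      = λ i → restrict-zero used? φ (left i)
    ; right     = λ i → restrict-zero used? φ (right i)
    ; top       = λ j → restrict-zero used? φ (top j)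
    ; bottom    = λ j → restrict-zero used? φ (bottom j)
    ; conserved = λ i j → Equivalence.from (conserved⇔outflow-total≡0 ψ i j) (outflow-total-ψ (i , j))
    }
    where open IsCirculation circ

  heading : Fin (len cycle) → Bool
  heading k = isHorizontal (dir k)

  rowDiff-ψ-at-cycle : ∀ k →
    rowDiff ψ (row (vertex k)) (col (vertex k)) ≡ indicator (heading k) ℤ.- indicator (heading (prev cycle k))
  rowDiff-ψ-at-cycle k = begin
    outflow ψ R (vertex k) ℤ.+ outflow ψ L (vertex k)
      ≡⟨ cong₂ ℤ._+_ (outflow-ψ-at-cycle k R) (outflow-ψ-at-cycle k L) ⟩
    (δ (dir k) R ℤ.- δ (inDir k) R) ℤ.+ (δ (dir k) L ℤ.- δ (inDir k) L)
      ≡⟨ regroup (δ (dir k) R) (δ (inDir k) R) (δ (dir k) L) (δ (inDir k) L) ⟩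
    (δ (dir k) R ℤ.+ δ (dir k) L) ℤ.- (δ (inDir k) R ℤ.+ δ (inDir k) L)
      ≡⟨ cong₂ ℤ._-_ (δ-horizontal (dir k)) (δ-horizontal (inDir k)) ⟩
    indicator (heading k) ℤ.- indicator (heading (prev cycle k))
      ∎
    where
    open ≡-Reasoning
    regroup : ∀ a b c d → (a ℤ.- b) ℤ.+ (c ℤ.- d) ≡ (a ℤ.+ c) ℤ.- (b ℤ.+ d)
    regroup = solve-∀

  rowDiff-ψ-off-cycle : ∀ {i j} → (∀ k → vertex k ≢ (i , j)) → rowDiff ψ i j ≡ + 0
  rowDiff-ψ-off-cycle off = cong₂ ℤ._+_ (outflow-ψ-off-cycle off R) (outflow-ψ-off-cycle off L)

  isCorner⇔turn : ∀ k → IsCorner cycle k ⇔ (heading (prev cycle k) ≡ not (heading k))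
  isCorner⇔turn k = mk⇔ to from
    where
    to : IsCorner cycle k → heading (prev cycle k) ≡ not (heading k)
    to (inj₁ (h , v)) = trans (move-HEdge⇒horizontal (moves-in k) h) (cong not (sym (move-VEdge⇒vertical (moves k) v)))
    to (inj₂ (v , h)) = trans (move-VEdge⇒vertical (moves-in k) v) (cong not (sym (move-HEdge⇒horizontal (moves k) h)))
    from : heading (prev cycle k) ≡ not (heading k) → IsCorner cycle k
    from turn with heading k in eq
    ... | true  = inj₂ (move⇒VEdge (moves-in k) turn , move⇒HEdge (moves k) eq)
    ... | false = inj₁ (move⇒HEdge (moves-in k) turn , move⇒VEdge (moves k) eq)

  straight : ∀ k → ¬ IsCorner cycle k → heading (prev cycle k) ≡ heading k
  straight k ¬corner =
    trans (Boolₚ.¬-not (¬corner ∘ Equivalence.from (isCorner⇔turn k))) (Boolₚ.not-involutive (heading k))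

  heading-before : ∀ k d → (∀ e → 1 ≤ e → e < d → ¬ IsCorner cycle (cshift k e)) →
    ∀ e → 1 ≤ e → e ≤ d → heading (prev cycle (cshift k e)) ≡ heading k
  heading-before k d straight-between (suc zero) _ _ =
    cong heading (trans (prev-cshift-suc k 0) (cshift-0 k))
  heading-before k d straight-between (suc (suc e)) _ 2+e≤d = begin
    heading (prev cycle (cshift k (suc (suc e))))  ≡⟨ cong heading (prev-cshift-suc k (suc e)) ⟩
    heading (cshift k (suc e))                     ≡⟨ straight _ (straight-between (suc e) (s≤s z≤n) 2+e≤d) ⟨
    heading (prev cycle (cshift k (suc e)))        ≡⟨ heading-before k d straight-between (suc e) (s≤s z≤n) (ℕₚ.<⇒≤ 2+e≤d) ⟩
    heading k                                      ∎
    where open ≡-Reasoning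

  module _ (C : Matrix n) (C≡ : ∀ i j → C i j ≡ rowDiff ψ i j) where
    C-at : ∀ k → C (row (vertex k)) (col (vertex k)) ≡ indicator (heading k) ℤ.- indicator (heading (prev cycle k))
    C-at k = trans (C≡ _ _) (rowDiff-ψ-at-cycle k)

    C-at-position : ∀ {i j} k → vertex k ≡ (i , j) → C i j ≡ indicator (heading k) ℤ.- indicator (heading (prev cycle k))
    C-at-position k eq = trans (cong (λ u → C (row u) (col u)) (sym eq)) (C-at k)

    C-off : ∀ {i j} → (∀ k → vertex k ≢ (i , j)) → C i j ≡ + 0
    C-off off = trans (C≡ _ _) (rowDiff-ψ-off-cycle off)

    nonzero⇔corner : ∀ i j → (C i j ≢ + 0) ⇔ (Σ (Fin (len cycle)) λ k → IsCorner cycle k × (vertex k ≡ (i , j)))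
    nonzero⇔corner i j = mk⇔ to from
      where
      to : C i j ≢ + 0 → Σ (Fin (len cycle)) λ k → IsCorner cycle k × (vertex k ≡ (i , j))
      to nz with on-cycle? (i , j)
      ... | yes (k , eq) = k , Equivalence.from (isCorner⇔turn k)
                                 (indicator-difference≢0 (nz ∘ trans (C-at-position k eq))) , eq
      ... | no off = ⊥-elim (nz (C-off (λ k eq → off (k , eq))))
      from : (Σ (Fin (len cycle)) λ k → IsCorner cycle k × (vertex k ≡ (i , j))) → C i j ≢ + 0
      from (k , corner , eq) C≡0 = indicator-turn≢0 (heading k) (begin
        indicator (heading k) ℤ.- indicator (not (heading k))
          ≡⟨ cong (λ b → indicator (heading k) ℤ.- indicator b) (Equivalence.to (isCorner⇔turn k) corner) ⟨
        indicator (heading k) ℤ.- indicator (heading (prev cycle k))  ≡⟨ C-at-position k eq ⟨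
        C i j                                                       ≡⟨ C≡0 ⟩
        + 0                                                         ∎)
        where open ≡-Reasoning

    nonzero⇒unit : ∀ i j → C i j ≢ + 0 → (C i j ≡ + 1) ⊎ (C i j ≡ - (+ 1))
    nonzero⇒unit i j nz with on-cycle? (i , j)
    ... | no off = ⊥-elim (nz (C-off (λ k eq → off (k , eq))))
    ... | yes (k , eq)
      with subst Entry (sym (C-at-position k eq)) (indicator-difference-entry (heading k) (heading (prev cycle k)))
    ...   | inj₁ C≡0 = ⊥-elim (nz C≡0)
    ...   | inj₂ unit = unit

    alternates : ∀ (k : Fin (len cycle)) (d : ℕ) → IsCorner cycle k → 1 ≤ d → d < len cycle →
      IsCorner cycle (cshift k d) → (∀ e → 1 ≤ e → e < d → ¬ IsCorner cycle (cshift k e)) →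
      C (row (vertex (cshift k d))) (col (vertex (cshift k d))) ≡ - C (row (vertex k)) (col (vertex k))
    alternates k d corner 1≤d _ corner-d straight-between = begin
      C (row (vertex kd)) (col (vertex kd))
        ≡⟨ C-at kd ⟩
      indicator (heading kd) ℤ.- indicator (heading (prev cycle kd))
        ≡⟨ cong₂ (λ a b → indicator a ℤ.- indicator b) heading-kd before ⟩
      indicator (not b) ℤ.- indicator b
        ≡⟨ indicator-turn-neg b ⟩
      - (indicator b ℤ.- indicator (not b))
        ≡⟨ cong (λ a → - (indicator b ℤ.- indicator a)) (Equivalence.to (isCorner⇔turn k) corner) ⟨
      - (indicator b ℤ.- indicator (heading (prev cycle k)))
        ≡⟨ cong -_ (C-at k) ⟨
      - C (row (vertex k)) (col (vertex k))
        ∎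
      where
      open ≡-Reasoning
      kd : Fin (len cycle)
      kd = cshift k d
      b : Bool
      b = heading k
      before : heading (prev cycle kd) ≡ b
      before = heading-before k d straight-between d 1≤d ℕₚ.≤-refl
      heading-kd : heading kd ≡ not b
      heading-kd = trans (sym (Boolₚ.not-involutive (heading kd)))
                         (cong not (trans (sym (Equivalence.to (isCorner⇔turn kd) corner-d)) before))

    isCycleMatrix : IsCycleMatrixOf C cycle
    isCycleMatrix = nonzero⇔corner , nonzero⇒unit , alternates

-- Faces of ASM_n

/1-+ : ∀ x y → (x ℚ./ 1) ℚ.+ (y ℚ./ 1) ≡ (x ℤ.+ y) ℚ./ 1
/1-+ x y = ℚₚ.toℚᵘ-injective (ℚᵘₚ.≃-trans (ℚₚ.toℚᵘ-homo-+ (x ℚ./ 1) (y ℚ./ 1))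
  (ℚᵘₚ.≃-trans (ℚᵘₚ.+-cong (ℚₚ.toℚᵘ-fromℚᵘ (ℚᵘ.mkℚᵘ x 0)) (ℚₚ.toℚᵘ-fromℚᵘ (ℚᵘ.mkℚᵘ y 0)))
  (ℚᵘₚ.≃-trans integral-sum (ℚᵘₚ.≃-sym (ℚₚ.toℚᵘ-fromℚᵘ (ℚᵘ.mkℚᵘ (x ℤ.+ y) 0))))))
  where
  integral-sum : (ℚᵘ.mkℚᵘ x 0 ℚᵘ.+ ℚᵘ.mkℚᵘ y 0) ℚᵘ.≃ ℚᵘ.mkℚᵘ (x ℤ.+ y) 0
  integral-sum = ℚᵘ.*≡* (cong₂ (λ a b → (a ℤ.+ b) ℤ.* + 1) (ℤₚ.*-identityʳ x) (ℤₚ.*-identityʳ y))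

sumFinℚ-cong : ∀ {n} {f g : Fin n → ℚ} → (∀ i → f i ≡ g i) → sumFinℚ f ≡ sumFinℚ g
sumFinℚ-cong {zero}  f≡g = refl
sumFinℚ-cong {suc n} f≡g = cong₂ ℚ._+_ (f≡g Fin.zero) (sumFinℚ-cong (f≡g ∘ Fin.suc))

sumFinℚ-+ : ∀ {n} (f g : Fin n → ℚ) → sumFinℚ f ℚ.+ sumFinℚ g ≡ sumFinℚ (λ i → f i ℚ.+ g i)
sumFinℚ-+ {zero}  f g = ℚₚ.+-identityˡ ℚ.0ℚ
sumFinℚ-+ {suc n} f g = trans (interchange (f Fin.zero) _ (g Fin.zero) _)
  (cong ((f Fin.zero ℚ.+ g Fin.zero) ℚ.+_) (sumFinℚ-+ (f ∘ Fin.suc) (g ∘ Fin.suc)))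

⟨,⟩-+ : ∀ {n} (c : Fin n → Fin n → ℚ) (X Y : Matrix n) → ⟨ c , X ⟩ ℚ.+ ⟨ c , Y ⟩ ≡ ⟨ c , X +ᴹ Y ⟩
⟨,⟩-+ c X Y = trans (sumFinℚ-+ (λ i → sumFinℚ (term X i)) (λ i → sumFinℚ (term Y i)))
  (sumFinℚ-cong λ i → trans (sumFinℚ-+ (term X i) (term Y i)) (sumFinℚ-cong λ j →
    trans (sym (ℚₚ.*-distribˡ-+ (c i j) (X i j ℚ./ 1) (Y i j ℚ./ 1))) (cong (c i j ℚ.*_) (/1-+ (X i j) (Y i j)))))
  where
  term : Matrix _ → Fin _ → Fin _ → ℚ
  term M i j = c i j ℚ.* (M i j ℚ./ 1)

⟨,⟩-cong : ∀ {n} (c : Fin n → Fin n → ℚ) {X Y : Matrix n} → (∀ i j → X i j ≡ Y i j) → ⟨ c , X ⟩ ≡ ⟨ c , Y ⟩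
⟨,⟩-cong c X≐Y = sumFinℚ-cong λ i → sumFinℚ-cong λ j → cong (λ x → c i j ℚ.* (x ℚ./ 1)) (X≐Y i j)

≐-dec : ∀ {n} (X Y : Matrix n) → Dec (∀ i j → X i j ≡ Y i j)
≐-dec X Y = Finₚ.all? λ i → Finₚ.all? λ j → X i j ℤ.≟ Y i j

private
  cancelʳ : ∀ {x y z} → x ℤ.+ z ≡ y ℤ.+ z → x ≡ y
  cancelʳ {x} {y} {z} eq = trans (solved x z) (trans (cong (ℤ._- z) eq) (sym (solved y z)))
    where
    solved : ∀ a b → a ≡ (a ℤ.+ b) ℤ.- b
    solved = solve-∀

adjacent⇒unsplittable : ∀ {n} {A B X Y : Matrix n} → AdjacentInASMPolytope A B → IsASM X → IsASM Y →
  (∀ i j → X i j ℤ.+ Y i j ≡ A i j ℤ.+ B i j) → (∀ i j → X i j ≡ A i j) ⊎ (∀ i j → X i j ≡ B i j)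
adjacent⇒unsplittable {A = A} {B} {X} {Y} (_ , _ , _ , c , ⟨A⟩≡⟨B⟩ , maximal) asmX asmY X+Y≡A+B
  with ≐-dec X A | ≐-dec X B
... | yes X≐A | _         = inj₁ X≐A
... | no  _   | yes X≐B   = inj₂ X≐B
... | no  X≉A | no  X≉B   =
  ⊥-elim (ℚₚ.<-irrefl sums-agree (ℚₚ.+-mono-< (maximal X asmX X≉A X≉B) (maximal Y asmY Y≉A Y≉B)))
  where
  Y≉A : ¬ (∀ i j → Y i j ≡ A i j)
  Y≉A Y≐A = X≉B λ i j → cancelʳ
    (trans (cong (ℤ._+_ (X i j)) (sym (Y≐A i j))) (trans (X+Y≡A+B i j) (ℤₚ.+-comm (A i j) (B i j))))
  Y≉B : ¬ (∀ i j → Y i j ≡ B i j)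
  Y≉B Y≐B = X≉A λ i j → cancelʳ (trans (cong (ℤ._+_ (X i j)) (sym (Y≐B i j))) (X+Y≡A+B i j))
  sums-agree : ⟨ c , X ⟩ ℚ.+ ⟨ c , Y ⟩ ≡ ⟨ c , A ⟩ ℚ.+ ⟨ c , A ⟩
  sums-agree = begin
    ⟨ c , X ⟩ ℚ.+ ⟨ c , Y ⟩   ≡⟨ ⟨,⟩-+ c X Y ⟩
    ⟨ c , X +ᴹ Y ⟩           ≡⟨ ⟨,⟩-cong c X+Y≡A+B ⟩
    ⟨ c , A +ᴹ B ⟩           ≡⟨ ⟨,⟩-+ c A B ⟨
    ⟨ c , A ⟩ ℚ.+ ⟨ c , B ⟩   ≡⟨ cong (⟨ c , A ⟩ ℚ.+_) ⟨A⟩≡⟨B⟩ ⟨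
    ⟨ c , A ⟩ ℚ.+ ⟨ c , A ⟩   ∎
    where open ≡-Reasoning

-- Adjacent ASMs

≉⇒∃≢ : ∀ {n} {X Y : Matrix n} → ¬ (∀ i j → X i j ≡ Y i j) → Σ (Fin n) λ i → Σ (Fin n) λ j → X i j ≢ Y i j
≉⇒∃≢ {n} {X} {Y} X≉Y =
  let i , row-differs = Finₚ.¬∀⟶∃¬ n _ (λ i → Finₚ.all? λ j → X i j ℤ.≟ Y i j) X≉Y
  in  i , Finₚ.¬∀⟶∃¬ n _ (λ j → X i j ℤ.≟ Y i j) row-differs

private
  +-difference : ∀ {a r b} → a ℤ.+ r ≡ b → b ℤ.- a ≡ r
  +-difference {a} {r} refl = cancel a r
    where
    cancel : ∀ a r → (a ℤ.+ r) ℤ.- a ≡ r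
    cancel = solve-∀

module Difference {n} {A B : Matrix n} (asmA : IsASM A) (asmB : IsASM B) where

  private
    hA : IsHeightFunction A (heights A)
    hA = asm⇒heightFunction asmA
    hB : IsHeightFunction B (heights B)
    hB = asm⇒heightFunction asmB
    module hA = IsHeightFunction hA
    module hB = IsHeightFunction hB

  φ : Flow n
  φ = heights B -ᶠ heights A

  φ-circulation : IsCirculation φ
  φ-circulation = difference-isCirculation hA hB

  φ-trit : ∀ e → Trit (φ e)
  φ-trit e = bit-difference (hA.bit e) (hB.bit e)

  open UnitCirculation φ-circulation φ-trit using (HasOut; outflow≢0⇒hasOut; flowCycle)

  hasOut-where-different : ∀ {i j} → A i j ≢ B i j → HasOut (i , j)
  hasOut-where-different {i} {j} A≢B with outflow φ R (i , j) ℤ.≟ + 0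
  ... | no  R≢0 = outflow≢0⇒hasOut {R} R≢0
  ... | yes R≡0 = outflow≢0⇒hasOut {L} λ L≡0 → A≢B (sym (ℤₚ.i-j≡0⇒i≡j _ _ (begin
    B i j ℤ.- A i j                                  ≡⟨ rowDiff-difference hA hB i j ⟨
    outflow φ R (i , j) ℤ.+ outflow φ L (i , j)      ≡⟨ cong₂ ℤ._+_ R≡0 L≡0 ⟩
    + 0                                              ∎)))
    where open ≡-Reasoning

  flowCycle-where-different : ∀ {i j} → A i j ≢ B i j → FlowCycle φ
  flowCycle-where-different = flowCycle ∘ hasOut-where-different

  module Split (K : FlowCycle φ) where
    open CycleFlow K public

    X Y : Matrix n
    X = A +ᴹ rowDiff ψ
    Y = B +ᴹ rowDiff (-ᶠ ψ)

    private
      bits : ∀ e → Bit (heights A e ℤ.+ ψ e) × Bit (heights B e ℤ.+ - ψ e)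
      bits e = bits-between (hA.bit e) (hB.bit e) (restrict-kept-or-dropped used? φ e)

    X-asm : IsASM X
    X-asm = heightFunction⇒asm (heightFunction-+ hA (ψ-circulation φ-circulation) (proj₁ ∘ bits))

    Y-asm : IsASM Y
    Y-asm = heightFunction⇒asm (heightFunction-+ hB (circulation-neg (ψ-circulation φ-circulation)) (proj₂ ∘ bits))

    X+Y≡A+B : ∀ i j → X i j ℤ.+ Y i j ≡ A i j ℤ.+ B i j
    X+Y≡A+B i j = trans (cong (λ y → X i j ℤ.+ (B i j ℤ.+ y)) (rowDiff-neg ψ i j)) (cancel (A i j) (B i j) (rowDiff ψ i j))
      where
      cancel : ∀ a b r → (a ℤ.+ r) ℤ.+ (b ℤ.+ - r) ≡ a ℤ.+ b
      cancel = solve-∀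

    X≉A : ¬ (∀ i j → X i j ≡ A i j)
    X≉A X≐A = 1≢0 (begin
      + 1                               ≡⟨ carries k₀ ⟨
      outflow φ (dir k₀) (vertex k₀)    ≡⟨ outflow-restrict-kept used? φ (used-out k₀) ⟨
      outflow ψ (dir k₀) (vertex k₀)    ≡⟨ rowDiff≡0⇒outflow≡0 (ψ-circulation φ-circulation) rowDiff-ψ≡0 (dir k₀) (vertex k₀) ⟩
      + 0                               ∎)
      where
      open ≡-Reasoning
      1≢0 : + 1 ≢ + 0
      1≢0 ()
      k₀ : Fin (len cycle)
      k₀ = Fin.zero
      rowDiff-ψ≡0 : ∀ i j → rowDiff ψ i j ≡ + 0
      rowDiff-ψ≡0 i j = trans (sym (+-difference (X≐A i j))) (ℤₚ.+-inverseʳ (A i j))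

    X≐B : AdjacentInASMPolytope A B → ∀ i j → X i j ≡ B i j
    X≐B adjacent = [ ⊥-elim ∘ X≉A , id ]′ (adjacent⇒unsplittable adjacent X-asm Y-asm X+Y≡A+B)

    B-A≡rowDiff-ψ : AdjacentInASMPolytope A B → ∀ i j → (B -ᴹ A) i j ≡ rowDiff ψ i j
    B-A≡rowDiff-ψ adjacent i j = +-difference (X≐B adjacent i j)

mainTheorem16 : ∀ (n : ℕ) (A B : Matrix n) →
    AdjacentInASMPolytope A B → IsCycleMatrix (B -ᴹ A)
mainTheorem16 n A B adjacent@(asmA , asmB , A≉B , _) = cycle , isCycleMatrix (B -ᴹ A) (B-A≡rowDiff-ψ adjacent)
  where
  open Difference asmA asmB
  open Split (flowCycle-where-different (proj₂ (proj₂ (≉⇒∃≢ A≉B))))
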